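{- Let $G$ be a connected bipartite graph and let $Y$ be a Gyárfás decomposition of $G$. Let $B$ be a bag of $Y$ with level $1$ and let $G_B$ be the subgraph of $G$ induced by $B$ together with the union of all bags that are descendants of $B$ in $Y$ at levels $i'\not\equiv 1 \pmod 2$. Let $C$ be a connected component of $\widetilde{G_B}$ (the bipartite complement of $G_B$) and let $Y_C$ be a Gyárfás decomposition of $C$ whose initial vertex $r_C$ lies in $V(C)\cap B$. Let $B'$ be a bag of $Y_C$ with level $j\ge1$ and let $G_{B'}$ be the subgraph of $G$ induced by $B'$ together with the union of all bags of $Y_C$ that are descendants of $B'$ in $Y_C$ at levels $j'\not\equiv j\pmod 2$. Then $\operatorname{bind}(G_{B'})<\operatorname{bind}(G)$.
   Context: Bipartite graphs have a fixed bipartition inherited by induced subgraphs; the bipartite complement $\widetilde{H}$ of a bipartite graph $H$ has the same vertex set and bipartition, vertices on opposite sides being adjacent iff they are non-adjacent in $H$. The bipartite index $\operatorname{bind}(G)$ is the maximum $k$ such that $G$ contains vertices $a_1,\dots,a_k,b_1,\dots,b_k$ with all $a_i$ on one side, all $b_j$ on the other, and for all $1\le i<j\le k$, $a_i$ adjacent to $b_j$ and $b_i$ not adjacent to $a_j$. A Gyárfás decomposition of a connected graph $G$ is a rooted tree $Y$ such that: (1) the nodes (bags) are pairwise disjoint non-empty subsets of $V(G)$ with union $V(G)$; (2) the root bag is a single vertex (the initial vertex); (3) if $u\in B$, $u'\in B'$ are adjacent then one of $B,B'$ is an ancestor of the other (each node is its own ancestor); (4) for every bag $B$, the union of $B$ and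 its descendants induces a connected subgraph; (5) every non-root bag $B$ has a hook $h(B)$ in its parent bag adjacent to all vertices of $B$ and non-adjacent to all vertices in strict descendants of $B$. The level of a bag is the number of edges on the path in its tree to the root. -}

module Defs where

open import Data.Nat using (ℕ; zero; suc; _%_; _<_)
import Data.Nat
open import Data.Fin using (Fin) renaming (_<_ to _<ᶠ_)
open import Data.Bool using (Bool; true; false; not)
open import Data.Product using (Σ; ∃; _×_; _,_)
open import Data.Sum using (_⊎_)
open import Data.Unit using (⊤)
open import Relation.Nullary using (¬_)
open import Relation.Binary.PropositionalEquality using (_≡_; _≢_)
open import Function.Definitions using (Injective)

record BipGraph (n : ℕ) : Set where
  field
    side    : Fin n → Bool
    adj     : Fin n → Fin n → Bool
    adj-sym : ∀ x y → adj x y ≡ adj y x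
    adj-bip : ∀ x y → adj x y ≡ true → side x ≢ side y
open BipGraph public

-- Vertex subsets (induced subgraphs are given by their vertex sets).
VSet : ℕ → Set₁
VSet n = Fin n → Set

Edge : ∀ {n} → BipGraph n → Fin n → Fin n → Set
Edge G x y = adj G x y ≡ true

CoEdge : ∀ {n} → BipGraph n → Fin n → Fin n → Set
CoEdge G x y = (side G x ≢ side G y) × (adj G x y ≡ false)

data Reach {n} (R : Fin n → Fin n → Set) (U : VSet n) : Fin n → Fin n → Set where
  here : ∀ {x} → U x → Reach R U x x
  step : ∀ {x y z} → U x → R x y → Reach R U y z → Reach R U x z

Connected : ∀ {n} → (Fin n → Fin n → Set) → VSet n → Set
Connected R U = ∀ x y → U x → U y → Reach R U x y

IsComponent : ∀ {n} → (Fin n → Fin n → Set) → VSet n → VSet n → Set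
IsComponent R U C =
  (∀ x → C x → U x) × (∃ λ x → C x) × Connected R C
  × (∀ x y → C x → Reach R U x y → C y)

iter : ∀ {m} → (Fin m → Fin m) → ℕ → Fin m → Fin m
iter f zero    b = b
iter f (suc k) b = f (iter f k b)

record GyarfasDecomp {n} (R : Fin n → Fin n → Set) (U : VSet n) : Set where
  field
    m        : ℕ
    root     : Fin m
    parent   : Fin m → Fin m
    level    : Fin m → ℕ
    parent-root : parent root ≡ root
    level-root  : level root ≡ 0
    level-parent : ∀ b → b ≢ root → suc (level (parent b)) ≡ level b
    bagOf    : Fin n → Fin m
  Anc : Fin m → Fin m → Set
  Anc a b = ∃ λ k → iter parent k b ≡ a
  InBag : Fin m → Fin n → Set
  InBag b v = U v × bagOf v ≡ b
  InDesc : Fin m → Fin n → Set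
  InDesc b v = U v × Anc b (bagOf v)
  InStrictDesc : Fin m → Fin n → Set
  InStrictDesc b v = U v × Anc b (bagOf v) × bagOf v ≢ b
  field
    -- (1) bags are non-empty (disjointness and covering are built in via bagOf)
    nonempty : ∀ b → ∃ λ v → InBag b v
    init      : Fin n
    init-root : InBag root init
    root-single : ∀ v → InBag root v → v ≡ init
    edges-anc : ∀ u u' → U u → U u' → R u u' →
                Anc (bagOf u) (bagOf u') ⊎ Anc (bagOf u') (bagOf u)
    desc-conn : ∀ b → Connected R (InDesc b)
    hook : ∀ b → b ≢ root → Fin n
    hook-parent : ∀ b (nr : b ≢ root) → InBag (parent b) (hook b nr)
    hook-adj : ∀ b (nr : b ≢ root) v → InBag b v → R (hook b nr) v
    hook-nonadj : ∀ b (nr : b ≢ root) v → InStrictDesc b v → ¬ R (hook b nr) v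
open GyarfasDecomp public

ParitySub : ∀ {n} {R : Fin n → Fin n → Set} {U : VSet n} →
            (Y : GyarfasDecomp R U) → Fin (m Y) → VSet n
ParitySub {U = U} Y B v =
  U v × Anc Y B (bagOf Y v)
  × (bagOf Y v ≡ B ⊎ level Y (bagOf Y v) % 2 ≢ level Y B % 2)

BindChain : ∀ {n} → BipGraph n → VSet n → ℕ → Set
BindChain {n} G S k =
  Σ (Fin k → Fin n) λ a → Σ (Fin k → Fin n) λ b →
    Injective _≡_ _≡_ a × Injective _≡_ _≡_ b
    × (∀ i → S (a i)) × (∀ i → S (b i))
    × (∃ λ s → ∀ i → side G (a i) ≡ s × side G (b i) ≡ not s)
    × (∀ i j → i <ᶠ j → adj G (a i) (b j) ≡ true × adj G (b i) (a j) ≡ false)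

IsBind : ∀ {n} → BipGraph n → VSet n → ℕ → Set
IsBind G S k = BindChain G S k × (∀ k' → BindChain G S k' → k' Data.Nat.≤ k)

{-# OPTIONS --safe #-}
-- In a Gyárfás decomposition whose edges cross the bipartition, the side of a vertex is
-- determined by the parity of the level of its bag, since the hook of a bag is adjacent to it.
-- Hence in G_{B'} every vertex on the side opposite to the hook h' of B' lies in B' itself,
-- where h' is non-adjacent to it in G.  Dually there is a vertex w outside G_{B'}, on the
-- other side, adjacent in G to every vertex of G_{B'} on the side opposite to w: the hook of
-- the parent of B' when that parent is not the root of Y_C, and otherwise (then h' = r_C lies
-- in B) the hook of B in Y.  Putting the pair (w, h') in front of a maximum chain of G_{B'},
-- read backwards if w is on the wrong side, gives a longer chain of G.
module Submission where

open import Defs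
open import Data.Nat using (ℕ; zero; suc; _<_; _≤_; _≥_; _%_; z≤n; s≤s)
open import Data.Nat.Properties
  using (≤-refl; ≤-trans; <-trans; ≤-reflexive; n≤1+n; <⇒≱; n≮0; suc-injective; ∸-monoʳ-<)
open import Data.Fin using (Fin; opposite) renaming (zero to fzero; suc to fsuc; _<_ to _<ᶠ_)
open import Data.Fin.Properties using (_≟_; opposite-involutive; opposite-prop; toℕ<n)
open import Data.Vec.Functional using (_∷_)
open import Data.Bool using (Bool; true; false; not)
open import Data.Bool.Properties using (not-involutive; not-¬; ¬-not)
import Data.Bool.Properties as Bool
open import Data.Product using (Σ; _×_; _,_; proj₁; proj₂)
open import Data.Sum using (inj₁; inj₂)
open import Data.Empty using (⊥-elim)
open import Data.Unit using (⊤; tt)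
open import Relation.Nullary using (¬_; yes; no)
open import Relation.Binary.PropositionalEquality
  using (_≡_; _≢_; refl; sym; trans; cong; subst; ≢-sym; module ≡-Reasoning)
open import Function.Definitions using (Injective)

alternate : Bool → ℕ → Bool
alternate s zero    = s
alternate s (suc k) = not (alternate s k)

alternate-≡⇒%2-≡ : ∀ s j k → alternate s j ≡ alternate s k → j % 2 ≡ k % 2
alternate-≡⇒%2-≡ s zero          zero          _ = refl
alternate-≡⇒%2-≡ s zero          (suc zero)    e = ⊥-elim (not-¬ refl e)
alternate-≡⇒%2-≡ s zero          (suc (suc k)) e = alternate-≡⇒%2-≡ s 0 k (trans e (not-involutive _))
alternate-≡⇒%2-≡ s (suc zero)    zero          e = ⊥-elim (not-¬ refl (sym e))
alternate-≡⇒%2-≡ s (suc zero)    (suc zero)    _ = refl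
alternate-≡⇒%2-≡ s (suc zero)    (suc (suc k)) e = alternate-≡⇒%2-≡ s 1 k (trans e (not-involutive _))
alternate-≡⇒%2-≡ s (suc (suc j)) k             e =
  alternate-≡⇒%2-≡ s j k (trans (sym (not-involutive _)) e)

¬CoEdge⇒Edge : ∀ {n} (G : BipGraph n) {x y} → side G x ≢ side G y → ¬ CoEdge G x y → Edge G x y
¬CoEdge⇒Edge G {x} {y} x≢y ¬co with adj G x y
... | true  = refl
... | false = ⊥-elim (¬co (x≢y , refl))

module Levels {n} {R : Fin n → Fin n → Set} {U : VSet n} (Y : GyarfasDecomp R U) where

  level≡0⇒root : ∀ {b} → level Y b ≡ 0 → b ≡ root Y
  level≡0⇒root {b} l≡0 with b ≟ root Y
  ... | yes b≡root = b≡root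
  ... | no  b≢root with () ← trans (level-parent Y b b≢root) l≡0

  level≥1⇒nonroot : ∀ {b} → level Y b ≥ 1 → b ≢ root Y
  level≥1⇒nonroot l≥1 refl = n≮0 (subst (1 ≤_) (level-root Y) l≥1)

  level-parent-< : ∀ {b} → b ≢ root Y → level Y (parent Y b) < level Y b
  level-parent-< {b} b≢root = ≤-reflexive (level-parent Y b b≢root)

  level-parent-≤ : ∀ b → level Y (parent Y b) ≤ level Y b
  level-parent-≤ b with b ≟ root Y
  ... | yes refl = ≤-reflexive (cong (level Y) (parent-root Y))
  ... | no  b≢root = ≤-trans (n≤1+n _) (level-parent-< b≢root)

  Anc⇒level-≤ : ∀ {a b} → Anc Y a b → level Y a ≤ level Y b
  Anc⇒level-≤ (zero  , refl) = ≤-refl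
  Anc⇒level-≤ {b = b} (suc k , refl) =
    ≤-trans (level-parent-≤ (iter (parent Y) k b)) (Anc⇒level-≤ (k , refl))

  level<⇒¬Anc : ∀ {a b} → level Y b < level Y a → ¬ Anc Y a b
  level<⇒¬Anc lt anc = <⇒≱ lt (Anc⇒level-≤ anc)

  level<⇒∉ParitySub : ∀ {B v} → level Y (bagOf Y v) < level Y B → ¬ ParitySub Y B v
  level<⇒∉ParitySub lt (_ , anc , _) = level<⇒¬Anc lt anc

  level-hook-< : ∀ {B} (nr : B ≢ root Y) → level Y (bagOf Y (hook Y B nr)) < level Y B
  level-hook-< {B} nr =
    subst (λ b → level Y b < level Y B) (sym (proj₂ (hook-parent Y B nr))) (level-parent-< nr)

  ParitySub⊆InStrictDesc-parent : ∀ {B v} → B ≢ root Y →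
    ParitySub Y B v → InStrictDesc Y (parent Y B) v
  ParitySub⊆InStrictDesc-parent {B} {v} nr (Uv , (k , e) , _) =
    Uv , (suc k , cong (parent Y) e) , λ v∈P →
      level<⇒¬Anc (subst (λ b → level Y b < level Y B) (sym v∈P) (level-parent-< nr)) (k , e)

  module Sides (G : BipGraph n) (crossing : ∀ {x y} → R x y → side G x ≢ side G y) where

    side≡alternate : ∀ k {b v} → level Y b ≡ k → InBag Y b v →
      side G v ≡ alternate (side G (init Y)) k
    side≡alternate zero    l≡0 (Uv , v∈b) =
      cong (side G) (root-single Y _ (Uv , trans v∈b (level≡0⇒root l≡0)))
    side≡alternate (suc k) {b} {v} l≡k+1 v∈b = begin
      side G v       ≡⟨ ¬-not (≢-sym (crossing (hook-adj Y b nr v v∈b))) ⟩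
      not (side G h) ≡⟨ cong not (side≡alternate k level-P (hook-parent Y b nr)) ⟩
      alternate (side G (init Y)) (suc k) ∎
      where
      open ≡-Reasoning
      nr : b ≢ root Y
      nr = level≥1⇒nonroot (subst (1 ≤_) (sym l≡k+1) (s≤s z≤n))
      h : Fin n
      h = hook Y b nr
      level-P : level Y (parent Y b) ≡ k
      level-P = suc-injective (trans (level-parent Y b nr) l≡k+1)

    oppositeToHook⇒InBag : ∀ {B v} (nr : B ≢ root Y) → ParitySub Y B v →
      side G v ≢ side G (hook Y B nr) → InBag Y B v
    oppositeToHook⇒InBag nr (Uv , _ , inj₁ v∈B) _ = Uv , v∈B
    oppositeToHook⇒InBag {B} {v} nr (Uv , _ , inj₂ parity≢) v≢h =
      ⊥-elim (parity≢ (alternate-≡⇒%2-≡ s₀ (level Y (bagOf Y v)) (level Y B) (begin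
        alternate s₀ (level Y (bagOf Y v)) ≡⟨ sym (side≡alternate _ refl (Uv , refl)) ⟩
        side G v                           ≡⟨ ¬-not v≢h ⟩
        not (side G (hook Y B nr))         ≡⟨ cong not (side≡alternate _ refl (hook-parent Y B nr)) ⟩
        alternate s₀ (suc (level Y (parent Y B))) ≡⟨ cong (alternate s₀) (level-parent Y B nr) ⟩
        alternate s₀ (level Y B)           ∎)))
      where
      open ≡-Reasoning
      s₀ : Bool
      s₀ = side G (init Y)

record ChainHead {n} (G : BipGraph n) (S : VSet n) : Set where
  field
    a₀ b₀           : Fin n
    a₀∉S            : ¬ S a₀
    b₀∉S            : ¬ S b₀
    sides-differ    : side G a₀ ≢ side G b₀
    a₀-complete     : ∀ v → S v → side G v ≢ side G a₀ → adj G a₀ v ≡ true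
    b₀-anticomplete : ∀ v → S v → side G v ≢ side G b₀ → adj G b₀ v ≡ false

injective-∷ : ∀ {A : Set} {k} {x : A} {f : Fin k → A} →
  Injective _≡_ _≡_ f → (∀ i → x ≢ f i) → Injective _≡_ _≡_ (x ∷ f)
injective-∷ f-inj x∉f {fzero}  {fzero}  _ = refl
injective-∷ f-inj x∉f {fzero}  {fsuc j} e = ⊥-elim (x∉f j e)
injective-∷ f-inj x∉f {fsuc i} {fzero}  e = ⊥-elim (x∉f i (sym e))
injective-∷ f-inj x∉f {fsuc i} {fsuc j} e = cong fsuc (f-inj e)

opposite-< : ∀ {k} {i j : Fin k} → i <ᶠ j → opposite j <ᶠ opposite i
opposite-< {i = i} {j} i<j rewrite opposite-prop i | opposite-prop j =
  ∸-monoʳ-< (s≤s i<j) (toℕ<n j)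

opposite-injective : ∀ {k} {A : Set} {f : Fin k → A} →
  Injective _≡_ _≡_ f → Injective _≡_ _≡_ (λ i → f (opposite i))
opposite-injective f-inj {i} {j} e =
  trans (sym (opposite-involutive i))
        (trans (cong opposite (f-inj e)) (opposite-involutive j))

module _ {n} (G : BipGraph n) {S : VSet n} where

  chainSide : ∀ {k} → BindChain G S k → Bool
  chainSide (_ , _ , _ , _ , _ , _ , (s , _) , _) = s

  reverse : ∀ {k} (ch : BindChain G S k) →
    Σ (BindChain G S k) (λ ch′ → chainSide ch′ ≡ not (chainSide ch))
  reverse (a , b , a-inj , b-inj , Sa , Sb , (s , sides) , cross) =
    ( (λ i → b (opposite i)) , (λ i → a (opposite i))
    , opposite-injective b-inj , opposite-injective a-inj
    , (λ i → Sb (opposite i)) , (λ i → Sa (opposite i))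
    , (not s , λ i → proj₂ (sides (opposite i))
                   , trans (proj₁ (sides (opposite i))) (sym (not-involutive s)))
    , cross′ ) , refl
    where
    cross′ : ∀ i j → i <ᶠ j →
      adj G (b (opposite i)) (a (opposite j)) ≡ true × adj G (a (opposite i)) (b (opposite j)) ≡ false
    cross′ i j i<j with cross (opposite j) (opposite i) (opposite-< i<j)
    ... | ab , ba = trans (adj-sym G _ _) ab , trans (adj-sym G _ _) ba

  module _ (head : ChainHead G S) where
    open ChainHead head

    prepend-aligned : ∀ {k} (ch : BindChain G S k) → side G a₀ ≡ chainSide ch →
      BindChain G (λ _ → ⊤) (suc k)
    prepend-aligned (a , b , a-inj , b-inj , Sa , Sb , (s , sides) , cross) a₀-side =
      a₀ ∷ a , b₀ ∷ b
      , injective-∷ a-inj (λ i a₀≡ → a₀∉S (subst S (sym a₀≡) (Sa i)))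
      , injective-∷ b-inj (λ i b₀≡ → b₀∉S (subst S (sym b₀≡) (Sb i)))
      , (λ _ → tt) , (λ _ → tt) , (s , sides′) , cross′
      where
      b₀-side : side G b₀ ≡ not s
      b₀-side = trans (¬-not (≢-sym sides-differ)) (cong not a₀-side)
      sides′ : ∀ i → side G ((a₀ ∷ a) i) ≡ s × side G ((b₀ ∷ b) i) ≡ not s
      sides′ fzero    = a₀-side , b₀-side
      sides′ (fsuc i) = sides i
      cross′ : ∀ i j → i <ᶠ j →
        adj G ((a₀ ∷ a) i) ((b₀ ∷ b) j) ≡ true × adj G ((b₀ ∷ b) i) ((a₀ ∷ a) j) ≡ false
      cross′ fzero (fsuc j) _ =
          a₀-complete (b j) (Sb j) (λ e → not-¬ refl (trans (sym a₀-side) (trans (sym e) (proj₂ (sides j)))))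
        , b₀-anticomplete (a j) (Sa j) (λ e → not-¬ refl (trans (sym (proj₁ (sides j))) (trans e b₀-side)))
      cross′ (fsuc i) (fsuc j) (s≤s i<j) = cross i j i<j

    prepend : ∀ {k} → BindChain G S k → BindChain G (λ _ → ⊤) (suc k)
    prepend ch with side G a₀ Bool.≟ chainSide ch
    ... | yes aligned = prepend-aligned ch aligned
    ... | no  a₀≢s with ch′ , ch′-side ← reverse ch =
      prepend-aligned ch′ (trans (¬-not a₀≢s) (sym ch′-side))

    ChainHead⇒bind< : ∀ {p q} → IsBind G S p → IsBind G (λ _ → ⊤) q → p < q
    ChainHead⇒bind< (chain , _) (_ , maximal) = maximal _ (prepend chain)

module _ {n} (G : BipGraph n) {C : VSet n} (YC : GyarfasDecomp (CoEdge G) C) where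
  open Levels YC
  open Sides G proj₁

  coHook-anticomplete : ∀ {B} (nr : B ≢ root YC) v → ParitySub YC B v →
    side G v ≢ side G (hook YC B nr) → adj G (hook YC B nr) v ≡ false
  coHook-anticomplete nr v v∈S v≢h = proj₂ (hook-adj YC _ nr v (oppositeToHook⇒InBag nr v∈S v≢h))

  coHooks-chainHead : ∀ {B} (nr : B ≢ root YC) (P≢root : parent YC B ≢ root YC) →
    ChainHead G (ParitySub YC B)
  coHooks-chainHead {B} nr P≢root = record
    { a₀              = hook YC (parent YC B) P≢root
    ; b₀              = hook YC B nr
    ; a₀∉S            = level<⇒∉ParitySub (<-trans (level-hook-< P≢root) (level-parent-< nr))
    ; b₀∉S            = level<⇒∉ParitySub (level-hook-< nr)
    ; sides-differ    = proj₁ (hook-adj YC _ P≢root _ (hook-parent YC B nr))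
    ; a₀-complete     = λ v v∈S v≢a₀ → ¬CoEdge⇒Edge G (≢-sym v≢a₀)
                          (hook-nonadj YC _ P≢root v (ParitySub⊆InStrictDesc-parent nr v∈S))
    ; b₀-anticomplete = coHook-anticomplete nr
    }

  rootChild-chainHead : ∀ {U} (Y : GyarfasDecomp (Edge G) U) {B} (B≢root : B ≢ root Y) →
    (∀ v → C v → ParitySub Y B v) → bagOf Y (init YC) ≡ B →
    ∀ {B′} (nr : B′ ≢ root YC) → parent YC B′ ≡ root YC → ChainHead G (ParitySub YC B′)
  rootChild-chainHead Y {B} B≢root C⊆ init∈B {B′} nr P≡root = record
    { a₀              = hook Y B B≢root
    ; b₀              = h
    ; a₀∉S            = λ a₀∈S → LY.level<⇒∉ParitySub (LY.level-hook-< B≢root) (C⊆ _ (proj₁ a₀∈S))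
    ; b₀∉S            = level<⇒∉ParitySub (level-hook-< nr)
    ; sides-differ    = adj-bip G _ _ (hook-adj Y B B≢root h (proj₁ (C⊆ h h∈C) , h∈B))
    ; a₀-complete     = λ v v∈S v≢a₀ →
                          hook-adj Y B B≢root v (YS.oppositeToHook⇒InBag B≢root (C⊆ v (proj₁ v∈S)) v≢a₀)
    ; b₀-anticomplete = coHook-anticomplete nr
    }
    where
    module LY = Levels Y
    module YS = LY.Sides G (λ {x} {y} → adj-bip G x y)
    h : Fin n
    h = hook YC B′ nr
    h∈C : C h
    h∈C = proj₁ (hook-parent YC B′ nr)
    h∈B : bagOf Y h ≡ B
    h∈B = trans (cong (bagOf Y) (root-single YC h (h∈C , trans (proj₂ (hook-parent YC B′ nr)) P≡root)))
                init∈B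

lemma5p10 : ∀ {n} (G : BipGraph n) →
    Connected (Edge G) (λ _ → ⊤) →
    (Y : GyarfasDecomp (Edge G) (λ _ → ⊤)) →
    (B : Fin (m Y)) → level Y B ≡ 1 →
    (C : VSet n) → IsComponent (CoEdge G) (ParitySub Y B) C →
    (YC : GyarfasDecomp (CoEdge G) C) →
    bagOf Y (init YC) ≡ B →
    (B' : Fin (m YC)) → level YC B' ≥ 1 →
    (p q : ℕ) → IsBind G (ParitySub YC B') p → IsBind G (λ _ → ⊤) q →
    p < q
lemma5p10 G _ Y B level-B C (C⊆ParitySub , _) YC init∈B B' level-B' p q bind-p bind-q =
  ChainHead⇒bind< G head bind-p bind-q
  where
  B'≢root : B' ≢ root YC
  B'≢root = Levels.level≥1⇒nonroot YC level-B'
  head : ChainHead G (ParitySub YC B')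
  head with parent YC B' ≟ root YC
  ... | no  P≢root = coHooks-chainHead G YC B'≢root P≢root
  ... | yes P≡root = rootChild-chainHead G YC Y (Levels.level≥1⇒nonroot Y (≤-reflexive (sym level-B)))
                       C⊆ParitySub init∈B B'≢root P≡root
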